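{- Let $a\in\mathbb{Z}$, $k,d\in\mathbb{N}^{\ast}$ and $(s_d,\ldots,s_1)\in(\mathbb{N}^{\ast})^d$. Then, in $\prod_{p\text{ prime}}\mathbb{Q}_p$ (the series converging in $\mathbb{Q}_p$ in each component), $$\zeta_{f^{k;a}}(s_d,\ldots,s_1)=\sum_{l_d,\ldots,l_1\ge 0}\ \prod_{i=1}^{d}\binom{ -s_i}{l_i}a^{l_i}\cdot \zeta_{f^{k;0}}(s_d+l_d,\ldots,s_1+l_1).$$
   Context: For integers $M<N$ with $0\le M$ or $N\le 0$, and positive integers $t_1,\ldots,t_d$, set $H_{M<N}(t_d,\ldots,t_1)=\sum_{M<n_1<\cdots<n_d<N}\frac{1}{n_1^{t_1}\cdots n_d^{t_d}}$, and $H_N=H_{0<N}$. For $k\in\mathbb{N}^{\ast}$ and $a\in\mathbb{Z}$, the finite multiple zeta value is the element $\zeta_{f^{k;a}}(s_d,\ldots,s_1)=\big((p^k)^{s_d+\cdots+s_1}H_{ap^k<(a+1)p^k}(s_d,\ldots,s_1)\big)_{p\text{ prime}}\in\prod_{p}\mathbb{Q}_p$. The binomial coefficient $\binom{ -s}{l}=\frac{(-s)(-s-1)\cdots(-s-l+1)}{l!}$, and $0^0=1$. -}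

module Defs where

open import Data.Nat as ℕ using (ℕ; zero; suc)
open import Data.Nat.Divisibility using (_∣_)
open import Data.Integer as ℤ using (ℤ; +_; -[1+_])
open import Data.Rational as ℚ using (ℚ; 0ℚ; 1ℚ; _/_; ↥_; ↧ₙ_; 1/_; ≢-nonZero)
open import Data.Rational.Properties using (_≟_)
open import Data.List using (List; []; _∷_; foldr; map; upTo)
open import Data.Vec using (Vec; []; _∷_; sum)
open import Data.Sum using (_⊎_)
open import Data.Product using (_×_)
open import Relation.Nullary using (¬_; yes; no)
open import Relation.Binary.PropositionalEquality using (_≡_)

sumℚ : List ℚ → ℚ
sumℚ = foldr ℚ._+_ 0ℚ

ℤtoℚ : ℤ → ℚ
ℤtoℚ z = z / 1

-- total inverse on ℚ (inv 0 = 0; only ever applied to nonzero arguments here)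
inv : ℚ → ℚ
inv x with x ≟ 0ℚ
... | yes _ = 0ℚ
... | no x≢0 = 1/_ x {{≢-nonZero x≢0}}

-- number of integers n with M < n < N (0 if N ≤ M + 1)
count : ℤ → ℤ → ℕ
count M N with N ℤ.- M ℤ.- ℤ.1ℤ
... | + c = c
... | -[1+ _ ] = 0

rangeSum : ℤ → ℤ → (ℤ → ℚ) → ℚ
rangeSum M N f = sumℚ (map (λ i → f (M ℤ.+ ℤ.1ℤ ℤ.+ + i)) (upTo (count M N)))

invPow : ℤ → ℕ → ℚ
invPow n t = inv (ℤtoℚ (n ℤ.^ t))

-- H_{M<N}(t_d,…,t_1) where the vector lists (t_1, …, t_d), i.e. the i-th
-- entry of the vector (from 0) is t_{i+1}, attached to n_{i+1}:
--   Σ_{M<n_1<⋯<n_d<N} 1 / (n_1^{t_1} ⋯ n_d^{t_d})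
H : ∀ {d} → ℤ → ℤ → Vec ℕ d → ℚ
H M N [] = 1ℚ
H M N (t ∷ ts) = rangeSum M N (λ n → invPow n t ℚ.* H n N ts)

-- the p-component of ζ_{f^{k;a}}(s_d,…,s_1), vector s = (s_1,…,s_d):
--   (p^k)^{s_d+⋯+s_1} H_{a p^k < (a+1) p^k}(s_d,…,s_1)
ζf : ∀ {d} → (p k : ℕ) → (a : ℤ) → Vec ℕ d → ℚ
ζf p k a s =
  ℤtoℚ (+ ((p ℕ.^ k) ℕ.^ sum s))
  ℚ.* H (a ℤ.* + (p ℕ.^ k)) ((a ℤ.+ ℤ.1ℤ) ℤ.* + (p ℕ.^ k)) s

binomNeg : ℕ → ℕ → ℚ
binomNeg s zero = 1ℚ
binomNeg s (suc l) = binomNeg s l ℚ.* ((ℤ.- (+ s) ℤ.- + l) / suc l)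

boxSum : (d : ℕ) → ℕ → (Vec ℕ d → ℚ) → ℚ
boxSum zero L f = f []
boxSum (suc d) L f = sumℚ (map (λ j → boxSum d L (λ v → f (j ∷ v))) (upTo (suc L)))

-- p-adic smallness: v_p(x) ≥ m, i.e. x = 0, or p^m divides the numerator
-- and p does not divide the denominator (of the reduced fraction)
PAdicSmall : ℕ → ℕ → ℚ → Set
PAdicSmall p m x = (x ≡ 0ℚ) ⊎ ((p ℕ.^ m ∣ ℤ.∣ ↥ x ∣) × (¬ (p ∣ ↧ₙ x)))

-- the general term of the series at multi-index l = (l_1,…,l_d):
--   Π_i binom(-s_i, l_i) a^{l_i} · ζ_{f^{k;0}}(s_d+l_d,…,s_1+l_1)   (p-component)
prodBin : ∀ {d} → ℤ → Vec ℕ d → Vec ℕ d → ℚ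
prodBin a [] [] = 1ℚ
prodBin a (s ∷ ss) (l ∷ ls) = binomNeg s l ℚ.* ℤtoℚ (a ℤ.^ l) ℚ.* prodBin a ss ls

term : ∀ {d} → (p k : ℕ) → ℤ → Vec ℕ d → Vec ℕ d → ℚ
term p k a s l = prodBin a s l ℚ.* ζf p k (+ 0) (Data.Vec.zipWith ℕ._+_ s l)

-- Write P = p^k. Splitting off the smallest summation index n_1, both ζ_{f^{k;a}}(s) and the
-- partial sums of the series become sums over 0 < n < P, with factor (P/(aP+n))^{s_1} on one
-- side and the truncated expansion Σ_{j ≤ N} (-s_1 choose j) a^j (P/n)^{s_1+j} on the other.
-- Since v_p(n) < k, y = P/n has v_p(y) ≥ 1 and w = n/(aP+n) is p-integral with w (1 + a y) = 1,
-- so the two factors differ by y^{s_1} (w^{s_1} - Σ_{j ≤ N} (-s_1 choose j) (a y)^j), which has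
-- valuation > N by induction on s_1 via Pascal's rule. Induction on the depth then shows that
-- the N-th partial sum is p-adically within p^N of ζ_{f^{k;a}}(s), and the terms themselves
-- are small because P^{|t|} H_{0<P}(t) has valuation at least |t|.

module Submission where

open import Defs
open import Data.Nat using (ℕ; _≤_)
open import Data.Nat.Primality using (Prime)
open import Data.Integer using (ℤ)
open import Data.Rational using (_-_)
open import Data.Vec using (Vec)
open import Data.Vec.Relation.Unary.All using (All)
open import Data.Vec.Relation.Unary.Any using (Any)
open import Data.Product using (_×_; ∃-syntax)
open import Relation.Binary.PropositionalEquality using (_≢_)

open import Algebra.Bundles using (CommutativeRing)
open import Data.Empty using (⊥-elim)
open import Data.Fin as Fin using (Fin; toℕ)
import Data.Fin.Properties as FinP
open import Data.List as List using (applyUpTo; _∷_; [])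
import Data.List.Properties as ListP
open import Data.Nat as ℕ using (zero; suc)
open import Data.Nat.Divisibility as ℕD using (_∣_; divides)
open import Data.Nat.Primality using (euclidsLemma; prime⇒nonZero; prime⇒nonTrivial)
import Data.Nat.Coprimality as Coprime
import Data.Nat.Properties as ℕP
open import Data.Integer as ℤ using (+_; -[1+_])
import Data.Integer.Properties as ℤP
import Data.Integer.Divisibility.Signed as ℤD
open import Data.Integer.Tactic.RingSolver using (solve-∀) renaming (solve to solveℤ)
open import Data.Rational as ℚ using (ℚ; 0ℚ; 1ℚ; mkℚ)
import Data.Rational.Properties as ℚP
open import Data.Rational.Solver using (module +-*-Solver)
open import Data.Rational.Unnormalised as ℚᵘ using (mkℚᵘ; *≡*)
import Data.Rational.Unnormalised.Properties as ℚᵘP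
import Data.Vec as Vec
open import Data.Vec.Relation.Unary.Any using (here; there)
open import Data.Product using (_,_; proj₁; proj₂)
open import Data.Sum using (inj₁; inj₂)
open import Function using (_∘_)
open import Relation.Binary.PropositionalEquality
open import Relation.Nullary using (¬_; Dec; yes; no)

open CommutativeRing ℚP.+-*-commutativeRing using (commutativeSemiring; semiring; *-commutativeSemigroup)
open import Algebra.Properties.CommutativeSemigroup *-commutativeSemigroup
  using () renaming (interchange to *-interchange)
open import Algebra.Properties.CommutativeSemiring.Exp commutativeSemiring
  using (_^_; ^-homo-*; ^-distrib-*)
open import Algebra.Properties.Semiring.Sum semiring
  using ( sum-syntax; sum⁺-syntax; sum-cong-≗; sum-replicate-zero; sum-init-last
        ; ∑-distrib-+; ∑-comm; *-distribˡ-sum; *-distribʳ-sum)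

toℚᵘ-/ : ∀ z l → ℚ.toℚᵘ (z ℚ./ suc l) ℚᵘ.≃ mkℚᵘ z l
toℚᵘ-/ z l = ℚP.toℚᵘ-fromℚᵘ (mkℚᵘ z l)

ℤtoℚ-+ : ∀ a b → ℤtoℚ (a ℤ.+ b) ≡ ℤtoℚ a ℚ.+ ℤtoℚ b
ℤtoℚ-+ a b = ℚP.toℚᵘ-injective (ℚᵘP.≃-trans (toℚᵘ-/ (a ℤ.+ b) 0) (ℚᵘP.≃-sym
  (ℚᵘP.≃-trans (ℚP.toℚᵘ-homo-+ (ℤtoℚ a) (ℤtoℚ b)) (ℚᵘP.≃-trans (ℚᵘP.+-cong (toℚᵘ-/ a 0) (toℚᵘ-/ b 0)) (*≡* (eq a b))))))
  where
  eq : ∀ a b → (a ℤ.* + 1 ℤ.+ b ℤ.* + 1) ℤ.* + 1 ≡ (a ℤ.+ b) ℤ.* + 1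
  eq = solve-∀

ℤtoℚ-* : ∀ a b → ℤtoℚ (a ℤ.* b) ≡ ℤtoℚ a ℚ.* ℤtoℚ b
ℤtoℚ-* a b = ℚP.toℚᵘ-injective (ℚᵘP.≃-trans (toℚᵘ-/ (a ℤ.* b) 0) (ℚᵘP.≃-sym
  (ℚᵘP.≃-trans (ℚP.toℚᵘ-homo-* (ℤtoℚ a) (ℤtoℚ b)) (ℚᵘP.*-cong (toℚᵘ-/ a 0) (toℚᵘ-/ b 0)))))

ℤtoℚ-^ : ∀ a n → ℤtoℚ (a ℤ.^ n) ≡ ℤtoℚ a ^ n
ℤtoℚ-^ a zero = refl
ℤtoℚ-^ a (suc n) = trans (ℤtoℚ-* a (a ℤ.^ n)) (cong (ℤtoℚ a ℚ.*_) (ℤtoℚ-^ a n))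

ℕtoℚ-^ : ∀ a n → ℤtoℚ (+ (a ℕ.^ n)) ≡ ℤtoℚ (+ a) ^ n
ℕtoℚ-^ a zero = refl
ℕtoℚ-^ a (suc n) = trans (cong ℤtoℚ (ℤP.pos-* a (a ℕ.^ n)))
  (trans (ℤtoℚ-* (+ a) (+ (a ℕ.^ n))) (cong (ℤtoℚ (+ a) ℚ.*_) (ℕtoℚ-^ a n)))

ℤtoℚ-injective : ∀ {a b} → ℤtoℚ a ≡ ℤtoℚ b → a ≡ b
ℤtoℚ-injective {a} {b} eq with ℚᵘP.≃-trans (ℚᵘP.≃-sym (toℚᵘ-/ a 0))
  (ℚᵘP.≃-trans (ℚᵘP.≃-reflexive (cong ℚ.toℚᵘ eq)) (toℚᵘ-/ b 0))
... | *≡* a*1≡b*1 = trans (sym (ℤP.*-identityʳ a)) (trans a*1≡b*1 (ℤP.*-identityʳ b))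

*ℤtoℚ≡ℤtoℚ⇒cross : ∀ x v w → x ℚ.* ℤtoℚ v ≡ ℤtoℚ w → ℚ.↥ x ℤ.* v ≡ w ℤ.* ℚ.↧ x
*ℤtoℚ≡ℤtoℚ⇒cross x@(mkℚ n d _) v w eq
  with ℚᵘP.≃-trans (ℚᵘP.≃-sym (ℚᵘP.*-cong (ℚᵘP.≃-refl {mkℚᵘ n d}) (toℚᵘ-/ v 0)))
         (ℚᵘP.≃-trans (ℚᵘP.≃-sym (ℚP.toℚᵘ-homo-* x (ℤtoℚ v)))
           (ℚᵘP.≃-trans (ℚᵘP.≃-reflexive (cong ℚ.toℚᵘ eq)) (toℚᵘ-/ w 0)))
... | *≡* nv*1≡w*d = trans (sym (ℤP.*-identityʳ (n ℤ.* v)))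
                       (trans nv*1≡w*d (cong (λ t → w ℤ.* + t) (ℕP.*-identityʳ (suc d))))

ℤtoℚ-*-/-exact : ∀ X z Y l → + suc l ℤ.* Y ≡ z ℤ.* X → ℤtoℚ X ℚ.* (z ℚ./ suc l) ≡ ℤtoℚ Y
ℤtoℚ-*-/-exact X z Y l eq = ℚP.toℚᵘ-injective (ℚᵘP.≃-trans (ℚP.toℚᵘ-homo-* (ℤtoℚ X) (z ℚ./ suc l))
  (ℚᵘP.≃-trans (ℚᵘP.*-cong (toℚᵘ-/ X 0) (toℚᵘ-/ z l)) (ℚᵘP.≃-trans (*≡* cross) (ℚᵘP.≃-sym (toℚᵘ-/ Y 0)))))
  where
  cross : (X ℤ.* z) ℤ.* + 1 ≡ Y ℤ.* + suc (l ℕ.+ 0)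
  cross rewrite ℕP.+-identityʳ l = trans (ℤP.*-identityʳ (X ℤ.* z))
    (trans (ℤP.*-comm X z) (trans (sym eq) (ℤP.*-comm (+ suc l) Y)))

inv-inverseʳ : ∀ {x} → x ≢ 0ℚ → x ℚ.* inv x ≡ 1ℚ
inv-inverseʳ {x} x≢0 with x ℚP.≟ 0ℚ
... | yes x≡0 = ⊥-elim (x≢0 x≡0)
... | no x≢0′ = ℚP.*-inverseʳ x {{ℚ.≢-nonZero x≢0′}}

inv-unique : ∀ x {y} → x ℚ.* y ≡ 1ℚ → inv x ≡ y
inv-unique x {y} xy≡1 = begin
  inv x                    ≡⟨ sym (ℚP.*-identityʳ (inv x)) ⟩
  inv x ℚ.* 1ℚ             ≡⟨ cong (inv x ℚ.*_) (sym xy≡1) ⟩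
  inv x ℚ.* (x ℚ.* y)      ≡⟨ sym (ℚP.*-assoc (inv x) x y) ⟩
  (inv x ℚ.* x) ℚ.* y      ≡⟨ cong (ℚ._* y) (trans (ℚP.*-comm (inv x) x) (inv-inverseʳ x≢0)) ⟩
  1ℚ ℚ.* y                 ≡⟨ ℚP.*-identityˡ y ⟩
  y                        ∎
  where
  open ≡-Reasoning
  x≢0 : x ≢ 0ℚ
  x≢0 refl = ℚP.1≢0 (trans (sym xy≡1) (ℚP.*-zeroˡ y))

inv-* : ∀ x y → inv (x ℚ.* y) ≡ inv x ℚ.* inv y
inv-* x y = by-cases (x ℚP.≟ 0ℚ) (y ℚP.≟ 0ℚ)
  where
  open ≡-Reasoning
  by-cases : Dec (x ≡ 0ℚ) → Dec (y ≡ 0ℚ) → inv (x ℚ.* y) ≡ inv x ℚ.* inv y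
  by-cases (yes refl) _ = trans (cong inv (ℚP.*-zeroˡ y)) (sym (ℚP.*-zeroˡ (inv y)))
  by-cases (no _) (yes refl) = trans (cong inv (ℚP.*-zeroʳ x)) (sym (ℚP.*-zeroʳ (inv x)))
  by-cases (no x≢0) (no y≢0) = inv-unique (x ℚ.* y) (begin
    (x ℚ.* y) ℚ.* (inv x ℚ.* inv y)  ≡⟨ *-interchange x y (inv x) (inv y) ⟩
    (x ℚ.* inv x) ℚ.* (y ℚ.* inv y)  ≡⟨ cong₂ ℚ._*_ (inv-inverseʳ x≢0) (inv-inverseʳ y≢0) ⟩
    1ℚ                               ∎)

inv-^ : ∀ x n → inv (x ^ n) ≡ inv x ^ n
inv-^ x zero = refl
inv-^ x (suc n) = trans (inv-* x (x ^ n)) (cong (inv x ℚ.*_) (inv-^ x n))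

*-≢0 : ∀ {x y} → x ≢ 0ℚ → y ≢ 0ℚ → x ℚ.* y ≢ 0ℚ
*-≢0 {x} {y} x≢0 y≢0 xy≡0 = ℚP.1≢0 (begin
  1ℚ                               ≡⟨ sym (cong₂ ℚ._*_ (inv-inverseʳ x≢0) (inv-inverseʳ y≢0)) ⟩
  (x ℚ.* inv x) ℚ.* (y ℚ.* inv y)  ≡⟨ *-interchange x (inv x) y (inv y) ⟩
  (x ℚ.* y) ℚ.* (inv x ℚ.* inv y)  ≡⟨ cong (ℚ._* (inv x ℚ.* inv y)) xy≡0 ⟩
  0ℚ ℚ.* (inv x ℚ.* inv y)         ≡⟨ ℚP.*-zeroˡ (inv x ℚ.* inv y) ⟩
  0ℚ                               ∎)
  where
  open ≡-Reasoning

*-inv-cancelˡ : ∀ c x y → c ≢ 0ℚ → (c ℚ.* x) ℚ.* inv (c ℚ.* y) ≡ x ℚ.* inv y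
*-inv-cancelˡ c x y c≢0 = begin
  (c ℚ.* x) ℚ.* inv (c ℚ.* y)      ≡⟨ cong ((c ℚ.* x) ℚ.*_) (inv-* c y) ⟩
  (c ℚ.* x) ℚ.* (inv c ℚ.* inv y)  ≡⟨ *-interchange c x (inv c) (inv y) ⟩
  (c ℚ.* inv c) ℚ.* (x ℚ.* inv y)  ≡⟨ cong (ℚ._* (x ℚ.* inv y)) (inv-inverseʳ c≢0) ⟩
  1ℚ ℚ.* (x ℚ.* inv y)             ≡⟨ ℚP.*-identityˡ (x ℚ.* inv y) ⟩
  x ℚ.* inv y                      ∎
  where
  open ≡-Reasoning

sumℚ-map-applyUpTo : ∀ (f : ℕ → ℚ) g n → sumℚ (List.map f (applyUpTo g n)) ≡ ∑[ i < n ] f (g (toℕ i))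
sumℚ-map-applyUpTo f g zero = refl
sumℚ-map-applyUpTo f g (suc n) = cong (f (g 0) ℚ.+_) (sumℚ-map-applyUpTo f (g ∘ suc) n)

∑-distrib-- : ∀ {n} (f g : Fin n → ℚ) → ∑[ i < n ] f i - ∑[ i < n ] g i ≡ ∑[ i < n ] (f i - g i)
∑-distrib-- {n} f g = sym (begin
  ∑[ i < n ] (f i - g i)
    ≡⟨ sym (add-sub _ (∑[ i < n ] g i)) ⟩
  (∑[ i < n ] (f i - g i) ℚ.+ ∑[ i < n ] g i) - ∑[ i < n ] g i
    ≡⟨ cong (_- ∑[ i < n ] g i) (sym (∑-distrib-+ _ g)) ⟩
  ∑[ i < n ] ((f i - g i) ℚ.+ g i) - ∑[ i < n ] g i
    ≡⟨ cong (_- ∑[ i < n ] g i) (sum-cong-≗ (λ i → sub-add (f i) (g i))) ⟩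
  ∑[ i < n ] f i - ∑[ i < n ] g i
    ∎)
  where
  open ≡-Reasoning
  open +-*-Solver
  add-sub : ∀ a b → (a ℚ.+ b) - b ≡ a
  add-sub = solve 2 (λ a b → (a :+ b) :- b := a) refl
  sub-add : ∀ a b → (a - b) ℚ.+ b ≡ a
  sub-add = solve 2 (λ a b → (a :- b) :+ b := a) refl

rangeIndex : ∀ M N → Fin (count M N) → ℤ
rangeIndex M N i = M ℤ.+ ℤ.1ℤ ℤ.+ + toℕ i

rangeSum-∑ : ∀ M N f → rangeSum M N f ≡ ∑[ i < count M N ] f (rangeIndex M N i)
rangeSum-∑ M N f = sumℚ-map-applyUpTo (λ i → f (M ℤ.+ ℤ.1ℤ ℤ.+ + i)) (λ i → i) (count M N)

clamp : ℤ → ℕ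
clamp (+ c) = c
clamp -[1+ _ ] = 0

count≡clamp : ∀ M N → count M N ≡ clamp (N ℤ.- M ℤ.- ℤ.1ℤ)
count≡clamp M N with N ℤ.- M ℤ.- ℤ.1ℤ
... | + c = refl
... | -[1+ _ ] = refl

rangeIndex-bounds : ∀ M N i → M ℤ.< rangeIndex M N i × rangeIndex M N i ℤ.< N
rangeIndex-bounds M N i =
  ℤP.suc[i]≤j⇒i<j (subst (ℤ._≤ rangeIndex M N i) (ℤP.+-comm M ℤ.1ℤ) (ℤP.i≤i+j (M ℤ.+ ℤ.1ℤ) (+ toℕ i))) ,
  below (N ℤ.- M ℤ.- ℤ.1ℤ) refl (subst (toℕ i ℕ.<_) (count≡clamp M N) (FinP.toℕ<n i))
  where
  open ℤP.≤-Reasoning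
  M+1+[N-M-1]≡N : ∀ M N → M ℤ.+ ℤ.1ℤ ℤ.+ (N ℤ.- M ℤ.- ℤ.1ℤ) ≡ N
  M+1+[N-M-1]≡N = solve-∀
  below : ∀ z → N ℤ.- M ℤ.- ℤ.1ℤ ≡ z → toℕ i ℕ.< clamp z → rangeIndex M N i ℤ.< N
  below (+ c) eq i<c = begin-strict
    M ℤ.+ ℤ.1ℤ ℤ.+ + toℕ i   <⟨ ℤP.+-monoʳ-< (M ℤ.+ ℤ.1ℤ) (ℤ.+<+ i<c) ⟩
    M ℤ.+ ℤ.1ℤ ℤ.+ + c       ≡⟨ cong (λ z → M ℤ.+ ℤ.1ℤ ℤ.+ z) (sym eq) ⟩
    M ℤ.+ ℤ.1ℤ ℤ.+ (N ℤ.- M ℤ.- ℤ.1ℤ)  ≡⟨ M+1+[N-M-1]≡N M N ⟩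
    N                        ∎

rangeSum-shift : ∀ c M N f → rangeSum (c ℤ.+ M) (c ℤ.+ N) f ≡ rangeSum M N (λ n → f (c ℤ.+ n))
rangeSum-shift c M N f = begin
  sumℚ (List.map (λ i → f (c ℤ.+ M ℤ.+ ℤ.1ℤ ℤ.+ + i)) (List.upTo (count (c ℤ.+ M) (c ℤ.+ N))))
    ≡⟨ cong (λ m → sumℚ (List.map (λ i → f (c ℤ.+ M ℤ.+ ℤ.1ℤ ℤ.+ + i)) (List.upTo m))) count-shift ⟩
  sumℚ (List.map (λ i → f (c ℤ.+ M ℤ.+ ℤ.1ℤ ℤ.+ + i)) (List.upTo (count M N)))
    ≡⟨ cong sumℚ (ListP.map-cong (λ i → cong f (reassoc c M (+ i))) (List.upTo (count M N))) ⟩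
  sumℚ (List.map (λ i → f (c ℤ.+ (M ℤ.+ ℤ.1ℤ ℤ.+ + i))) (List.upTo (count M N)))
    ∎
  where
  open ≡-Reasoning
  reassoc : ∀ c M i → c ℤ.+ M ℤ.+ ℤ.1ℤ ℤ.+ i ≡ c ℤ.+ (M ℤ.+ ℤ.1ℤ ℤ.+ i)
  reassoc = solve-∀
  width : ∀ c M N → (c ℤ.+ N) ℤ.- (c ℤ.+ M) ℤ.- ℤ.1ℤ ≡ N ℤ.- M ℤ.- ℤ.1ℤ
  width = solve-∀
  count-shift : count (c ℤ.+ M) (c ℤ.+ N) ≡ count M N
  count-shift = trans (count≡clamp (c ℤ.+ M) (c ℤ.+ N)) (trans (cong clamp (width c M N)) (sym (count≡clamp M N)))

rangeSum-cong : ∀ M N {f g : ℤ → ℚ} → (∀ n → f n ≡ g n) → rangeSum M N f ≡ rangeSum M N g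
rangeSum-cong M N f≗g = cong sumℚ (ListP.map-cong (λ i → f≗g (M ℤ.+ ℤ.1ℤ ℤ.+ + i)) (List.upTo (count M N)))

*-distribˡ-rangeSum : ∀ c M N f → c ℚ.* rangeSum M N f ≡ rangeSum M N (λ n → c ℚ.* f n)
*-distribˡ-rangeSum c M N f = begin
  c ℚ.* rangeSum M N f                              ≡⟨ cong (c ℚ.*_) (rangeSum-∑ M N f) ⟩
  c ℚ.* ∑[ i < count M N ] f (ι i)                  ≡⟨ *-distribˡ-sum c (f ∘ ι) ⟩
  ∑[ i < count M N ] (c ℚ.* f (ι i))                ≡⟨ sym (rangeSum-∑ M N (λ n → c ℚ.* f n)) ⟩
  rangeSum M N (λ n → c ℚ.* f n)                    ∎
  where
  open ≡-Reasoning
  ι = rangeIndex M N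

rangeSum-distrib-- : ∀ M N f g → rangeSum M N f - rangeSum M N g ≡ rangeSum M N (λ n → f n - g n)
rangeSum-distrib-- M N f g = begin
  rangeSum M N f - rangeSum M N g                        ≡⟨ cong₂ _-_ (rangeSum-∑ M N f) (rangeSum-∑ M N g) ⟩
  ∑[ i < count M N ] f (ι i) - ∑[ i < count M N ] g (ι i)  ≡⟨ ∑-distrib-- (f ∘ ι) (g ∘ ι) ⟩
  ∑[ i < count M N ] (f (ι i) - g (ι i))                 ≡⟨ sym (rangeSum-∑ M N (λ n → f n - g n)) ⟩
  rangeSum M N (λ n → f n - g n)                         ∎
  where
  open ≡-Reasoning
  ι = rangeIndex M N

∑-rangeSum-comm : ∀ L M N (f : Fin L → ℤ → ℚ) →
  ∑[ j < L ] rangeSum M N (f j) ≡ rangeSum M N (λ n → ∑[ j < L ] f j n)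
∑-rangeSum-comm L M N f = begin
  ∑[ j < L ] rangeSum M N (f j)               ≡⟨ sum-cong-≗ (λ j → rangeSum-∑ M N (f j)) ⟩
  ∑[ j < L ] ∑[ i < count M N ] f j (ι i)     ≡⟨ ∑-comm (λ j i → f j (ι i)) ⟩
  ∑[ i < count M N ] ∑[ j < L ] f j (ι i)     ≡⟨ sym (rangeSum-∑ M N (λ n → ∑[ j < L ] f j n)) ⟩
  rangeSum M N (λ n → ∑[ j < L ] f j n)       ∎
  where
  open ≡-Reasoning
  ι = rangeIndex M N

boxSum-suc : ∀ d L f → boxSum (suc d) L f ≡ ∑[ j ≤ L ] boxSum d L (λ v → f (toℕ j Vec.∷ v))
boxSum-suc d L f = sumℚ-map-applyUpTo (λ j → boxSum d L (λ v → f (j Vec.∷ v))) (λ j → j) (suc L)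

boxSum-cong : ∀ d L {f g : Vec ℕ d → ℚ} → (∀ v → f v ≡ g v) → boxSum d L f ≡ boxSum d L g
boxSum-cong zero L f≗g = f≗g Vec.[]
boxSum-cong (suc d) L f≗g =
  cong sumℚ (ListP.map-cong (λ j → boxSum-cong d L (λ v → f≗g (j Vec.∷ v))) (List.upTo (suc L)))

*-distribˡ-boxSum : ∀ c d L f → c ℚ.* boxSum d L f ≡ boxSum d L (λ v → c ℚ.* f v)
*-distribˡ-boxSum c zero L f = refl
*-distribˡ-boxSum c (suc d) L f = begin
  c ℚ.* boxSum (suc d) L f
    ≡⟨ cong (c ℚ.*_) (boxSum-suc d L f) ⟩
  c ℚ.* ∑[ j ≤ L ] boxSum d L (λ v → f (toℕ j Vec.∷ v))
    ≡⟨ *-distribˡ-sum {suc L} c (λ j → boxSum d L (λ v → f (toℕ j Vec.∷ v))) ⟩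
  ∑[ j ≤ L ] (c ℚ.* boxSum d L (λ v → f (toℕ j Vec.∷ v)))
    ≡⟨ sum-cong-≗ {suc L} (λ j → *-distribˡ-boxSum c d L (λ v → f (toℕ j Vec.∷ v))) ⟩
  ∑[ j ≤ L ] boxSum d L (λ v → c ℚ.* f (toℕ j Vec.∷ v))
    ≡⟨ sym (boxSum-suc d L (λ v → c ℚ.* f v)) ⟩
  boxSum (suc d) L (λ v → c ℚ.* f v)
    ∎
  where open ≡-Reasoning

boxSum-rangeSum-comm : ∀ d L M N (f : Vec ℕ d → ℤ → ℚ) →
  boxSum d L (λ v → rangeSum M N (f v)) ≡ rangeSum M N (λ n → boxSum d L (λ v → f v n))
boxSum-rangeSum-comm zero L M N f = refl
boxSum-rangeSum-comm (suc d) L M N f = begin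
  boxSum (suc d) L (λ v → rangeSum M N (f v))
    ≡⟨ boxSum-suc d L (λ v → rangeSum M N (f v)) ⟩
  ∑[ j ≤ L ] boxSum d L (λ v → rangeSum M N (f (toℕ j Vec.∷ v)))
    ≡⟨ sum-cong-≗ {suc L} (λ j → boxSum-rangeSum-comm d L M N (λ v → f (toℕ j Vec.∷ v))) ⟩
  ∑[ j ≤ L ] rangeSum M N (λ n → boxSum d L (λ v → f (toℕ j Vec.∷ v) n))
    ≡⟨ ∑-rangeSum-comm (suc L) M N (λ j n → boxSum d L (λ v → f (toℕ j Vec.∷ v) n)) ⟩
  rangeSum M N (λ n → ∑[ j ≤ L ] boxSum d L (λ v → f (toℕ j Vec.∷ v) n))
    ≡⟨ rangeSum-cong M N (λ n → sym (boxSum-suc d L (λ v → f v n))) ⟩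
  rangeSum M N (λ n → boxSum (suc d) L (λ v → f v n))
    ∎
  where open ≡-Reasoning

-- Binomial coefficients (-s choose l)

-- Pascal's rule (-s choose l+1) = (-s-1 choose l+1) + (-s-1 choose l), solved for (-s-1 choose l+1)
negBinom : ℕ → ℕ → ℤ
negBinom s zero = + 1
negBinom zero (suc l) = + 0
negBinom (suc s) (suc l) = negBinom s (suc l) ℤ.- negBinom (suc s) l

private
  ratio-step : ∀ s l X Y Z → (+ 1 ℤ.+ l) ℤ.* X ≡ (ℤ.- s ℤ.- l) ℤ.* Y → s ℤ.* Z ≡ (s ℤ.+ l) ℤ.* Y →
               (+ 1 ℤ.+ l) ℤ.* (X ℤ.- Z) ≡ (ℤ.- (+ 1 ℤ.+ s) ℤ.- l) ℤ.* Z
  ratio-step s l X Y Z ratio shift = begin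
    (+ 1 ℤ.+ l) ℤ.* (X ℤ.- Z)                    ≡⟨ solveℤ (l ∷ X ∷ Z ∷ []) ⟩
    (+ 1 ℤ.+ l) ℤ.* X ℤ.- (+ 1 ℤ.+ l) ℤ.* Z      ≡⟨ cong (ℤ._- (+ 1 ℤ.+ l) ℤ.* Z) ratio ⟩
    (ℤ.- s ℤ.- l) ℤ.* Y ℤ.- (+ 1 ℤ.+ l) ℤ.* Z    ≡⟨ solveℤ (s ∷ l ∷ Y ∷ Z ∷ []) ⟩
    ℤ.- ((s ℤ.+ l) ℤ.* Y) ℤ.- (+ 1 ℤ.+ l) ℤ.* Z  ≡⟨ cong (λ t → ℤ.- t ℤ.- (+ 1 ℤ.+ l) ℤ.* Z) (sym shift) ⟩
    ℤ.- (s ℤ.* Z) ℤ.- (+ 1 ℤ.+ l) ℤ.* Z          ≡⟨ solveℤ (s ∷ l ∷ Z ∷ []) ⟩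
    (ℤ.- (+ 1 ℤ.+ s) ℤ.- l) ℤ.* Z                ∎
    where open ≡-Reasoning

  shift-step : ∀ s l X Y Z → (+ 1 ℤ.+ l) ℤ.* X ≡ (ℤ.- s ℤ.- l) ℤ.* Y → s ℤ.* Z ≡ (s ℤ.+ l) ℤ.* Y →
               s ℤ.* (X ℤ.- Z) ≡ (s ℤ.+ (+ 1 ℤ.+ l)) ℤ.* X
  shift-step s l X Y Z ratio shift = begin
    s ℤ.* (X ℤ.- Z)                      ≡⟨ solveℤ (s ∷ X ∷ Z ∷ []) ⟩
    s ℤ.* X ℤ.- s ℤ.* Z                  ≡⟨ cong (λ t → s ℤ.* X ℤ.- t) shift ⟩
    s ℤ.* X ℤ.- (s ℤ.+ l) ℤ.* Y          ≡⟨ solveℤ (s ∷ l ∷ X ∷ Y ∷ []) ⟩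
    s ℤ.* X ℤ.+ (ℤ.- s ℤ.- l) ℤ.* Y      ≡⟨ cong (λ t → s ℤ.* X ℤ.+ t) (sym ratio) ⟩
    s ℤ.* X ℤ.+ (+ 1 ℤ.+ l) ℤ.* X        ≡⟨ solveℤ (s ∷ l ∷ X ∷ []) ⟩
    (s ℤ.+ (+ 1 ℤ.+ l)) ℤ.* X            ∎
    where open ≡-Reasoning

mutual
  negBinom-ratio : ∀ s l → + suc l ℤ.* negBinom s (suc l) ≡ (ℤ.- + s ℤ.- + l) ℤ.* negBinom s l
  negBinom-ratio zero zero = refl
  negBinom-ratio zero (suc l) = trans (ℤP.*-zeroʳ (+ suc (suc l))) (sym (ℤP.*-zeroʳ (ℤ.- + 0 ℤ.- + suc l)))
  negBinom-ratio (suc s) l = ratio-step (+ s) (+ l) (negBinom s (suc l)) (negBinom s l) (negBinom (suc s) l)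
    (negBinom-ratio s l) (negBinom-shift s l)

  negBinom-shift : ∀ s l → + s ℤ.* negBinom (suc s) l ≡ (+ s ℤ.+ + l) ℤ.* negBinom s l
  negBinom-shift s zero = cong (ℤ._* + 1) (sym (ℤP.+-identityʳ (+ s)))
  negBinom-shift s (suc l) = shift-step (+ s) (+ l) (negBinom s (suc l)) (negBinom s l) (negBinom (suc s) l)
    (negBinom-ratio s l) (negBinom-shift s l)

binomNeg≡negBinom : ∀ s l → binomNeg s l ≡ ℤtoℚ (negBinom s l)
binomNeg≡negBinom s zero = refl
binomNeg≡negBinom s (suc l) = trans (cong (ℚ._* ((ℤ.- (+ s) ℤ.- + l) ℚ./ suc l)) (binomNeg≡negBinom s l))
  (ℤtoℚ-*-/-exact (negBinom s l) (ℤ.- (+ s) ℤ.- + l) (negBinom s (suc l)) l (negBinom-ratio s l))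

binomNeg-pascal : ∀ s j → binomNeg s (suc j) ≡ binomNeg (suc s) (suc j) ℚ.+ binomNeg (suc s) j
binomNeg-pascal s j = begin
  binomNeg s (suc j)
    ≡⟨ binomNeg≡negBinom s (suc j) ⟩
  ℤtoℚ X
    ≡⟨ cong ℤtoℚ (sub-add X Z) ⟩
  ℤtoℚ ((X ℤ.- Z) ℤ.+ Z)
    ≡⟨ ℤtoℚ-+ (X ℤ.- Z) Z ⟩
  ℤtoℚ (X ℤ.- Z) ℚ.+ ℤtoℚ Z
    ≡⟨ sym (cong₂ ℚ._+_ (binomNeg≡negBinom (suc s) (suc j)) (binomNeg≡negBinom (suc s) j)) ⟩
  binomNeg (suc s) (suc j) ℚ.+ binomNeg (suc s) j
    ∎
  where
  open ≡-Reasoning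
  X = negBinom s (suc j)
  Z = negBinom (suc s) j
  sub-add : ∀ X Z → X ≡ (X ℤ.- Z) ℤ.+ Z
  sub-add = solve-∀

binomialSeries : ℕ → ℚ → ℕ → ℚ
binomialSeries s x N = ∑[ j ≤ N ] (binomNeg s (toℕ j) ℚ.* x ^ toℕ j)

binomialSeries-0 : ∀ x N → binomialSeries 0 x N ≡ 1ℚ
binomialSeries-0 x N = begin
  1ℚ ℚ.* 1ℚ ℚ.+ ∑[ j < N ] (binomNeg 0 (suc (toℕ j)) ℚ.* x ^ suc (toℕ j))
    ≡⟨ cong (1ℚ ℚ.+_) (sum-cong-≗ {N} (λ j → trans (cong (ℚ._* x ^ suc (toℕ j)) (binomNeg≡negBinom 0 (suc (toℕ j))))
                                             (ℚP.*-zeroˡ (x ^ suc (toℕ j))))) ⟩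
  1ℚ ℚ.+ ∑[ j < N ] 0ℚ                                  ≡⟨ cong (1ℚ ℚ.+_) (sum-replicate-zero N) ⟩
  1ℚ ℚ.+ 0ℚ                                             ≡⟨ ℚP.+-identityʳ 1ℚ ⟩
  1ℚ                                                    ∎
  where open ≡-Reasoning

binomialSeries-suc : ∀ s x N → binomialSeries s x (suc N) ≡ binomialSeries s x N ℚ.+ binomNeg s (suc N) ℚ.* x ^ suc N
binomialSeries-suc s x N = begin
  binomialSeries s x (suc N)
    ≡⟨ sum-init-last t ⟩
  ∑[ j ≤ N ] t (Fin.inject₁ j) ℚ.+ t (Fin.fromℕ (suc N))
    ≡⟨ cong₂ ℚ._+_ (sum-cong-≗ {suc N} (λ j → cong coeff (FinP.toℕ-inject₁ j))) (cong coeff (FinP.toℕ-fromℕ (suc N))) ⟩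
  binomialSeries s x N ℚ.+ coeff (suc N)
    ∎
  where
  open ≡-Reasoning
  coeff : ℕ → ℚ
  coeff j = binomNeg s j ℚ.* x ^ j
  t : Fin (suc (suc N)) → ℚ
  t j = coeff (toℕ j)

binomialSeries-step : ∀ s x N → binomialSeries s x (suc N) ≡
  (1ℚ ℚ.+ x) ℚ.* binomialSeries (suc s) x N ℚ.+ binomNeg (suc s) (suc N) ℚ.* x ^ suc N
binomialSeries-step s x N = begin
  coeff s 0 ℚ.+ ∑[ j < suc N ] coeff s (suc (toℕ j))
    ≡⟨ cong (coeff s 0 ℚ.+_) (sum-cong-≗ {suc N} (λ j → coeff-pascal (toℕ j))) ⟩
  coeff s 0 ℚ.+ ∑[ j < suc N ] (coeff (suc s) (suc (toℕ j)) ℚ.+ x ℚ.* coeff (suc s) (toℕ j))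
    ≡⟨ cong (coeff s 0 ℚ.+_) (∑-distrib-+ {suc N} (λ j → coeff (suc s) (suc (toℕ j))) (λ j → x ℚ.* coeff (suc s) (toℕ j))) ⟩
  coeff s 0 ℚ.+ (∑[ j < suc N ] coeff (suc s) (suc (toℕ j)) ℚ.+ ∑[ j < suc N ] (x ℚ.* coeff (suc s) (toℕ j)))
    ≡⟨ cong (λ t → coeff s 0 ℚ.+ (∑[ j < suc N ] coeff (suc s) (suc (toℕ j)) ℚ.+ t))
            (sym (*-distribˡ-sum {suc N} x (λ j → coeff (suc s) (toℕ j)))) ⟩
  coeff s 0 ℚ.+ (∑[ j < suc N ] coeff (suc s) (suc (toℕ j)) ℚ.+ x ℚ.* T)
    ≡⟨ sym (ℚP.+-assoc (coeff s 0) (∑[ j < suc N ] coeff (suc s) (suc (toℕ j))) (x ℚ.* T)) ⟩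
  binomialSeries (suc s) x (suc N) ℚ.+ x ℚ.* T
    ≡⟨ cong (ℚ._+ x ℚ.* T) (binomialSeries-suc (suc s) x N) ⟩
  (T ℚ.+ coeff (suc s) (suc N)) ℚ.+ x ℚ.* T
    ≡⟨ regroup T (coeff (suc s) (suc N)) x ⟩
  (1ℚ ℚ.+ x) ℚ.* T ℚ.+ coeff (suc s) (suc N)
    ∎
  where
  open ≡-Reasoning
  open +-*-Solver
  coeff : ℕ → ℕ → ℚ
  coeff s j = binomNeg s j ℚ.* x ^ j
  T = binomialSeries (suc s) x N
  regroup : ∀ T c x → (T ℚ.+ c) ℚ.+ x ℚ.* T ≡ (1ℚ ℚ.+ x) ℚ.* T ℚ.+ c
  regroup = solve 3 (λ T c x → (T :+ c) :+ x :* T := (con 1ℚ :+ x) :* T :+ c) refl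
  coeff-pascal : ∀ j → coeff s (suc j) ≡ coeff (suc s) (suc j) ℚ.+ x ℚ.* coeff (suc s) j
  coeff-pascal j = trans (cong (ℚ._* x ^ suc j) (binomNeg-pascal s j))
    (distrib (binomNeg (suc s) (suc j)) (binomNeg (suc s) j) x (x ^ j))
    where
    distrib : ∀ b₁ b₂ x y → (b₁ ℚ.+ b₂) ℚ.* (x ℚ.* y) ≡ b₁ ℚ.* (x ℚ.* y) ℚ.+ x ℚ.* (b₂ ℚ.* y)
    distrib = solve 4 (λ b₁ b₂ x y → (b₁ :+ b₂) :* (x :* y) := b₁ :* (x :* y) :+ x :* (b₂ :* y)) refl

-- Multiple harmonic sums scaled by C^(weight)

scaledH : ∀ {d} → ℤ → ℤ → ℤ → Vec ℕ d → ℚ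
scaledH C M N t = ℤtoℚ C ^ Vec.sum t ℚ.* H M N t

^-*-invPow : ∀ C n t → ℤtoℚ C ^ t ℚ.* invPow n t ≡ (ℤtoℚ C ℚ.* inv (ℤtoℚ n)) ^ t
^-*-invPow C n t = begin
  ℤtoℚ C ^ t ℚ.* inv (ℤtoℚ (n ℤ.^ t))     ≡⟨ cong (λ m → ℤtoℚ C ^ t ℚ.* inv m) (ℤtoℚ-^ n t) ⟩
  ℤtoℚ C ^ t ℚ.* inv (ℤtoℚ n ^ t)         ≡⟨ cong (ℤtoℚ C ^ t ℚ.*_) (inv-^ (ℤtoℚ n) t) ⟩
  ℤtoℚ C ^ t ℚ.* inv (ℤtoℚ n) ^ t         ≡⟨ sym (^-distrib-* (ℤtoℚ C) (inv (ℤtoℚ n)) t) ⟩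
  (ℤtoℚ C ℚ.* inv (ℤtoℚ n)) ^ t           ∎
  where open ≡-Reasoning

scaledH-cons : ∀ {d} C M N t (ts : Vec ℕ d) →
  scaledH C M N (t Vec.∷ ts) ≡ rangeSum M N (λ n → (ℤtoℚ C ℚ.* inv (ℤtoℚ n)) ^ t ℚ.* scaledH C n N ts)
scaledH-cons C M N t ts = begin
  ℤtoℚ C ^ (t ℕ.+ Vec.sum ts) ℚ.* rangeSum M N f
    ≡⟨ cong (ℚ._* rangeSum M N f) (^-homo-* (ℤtoℚ C) t (Vec.sum ts)) ⟩
  (ℤtoℚ C ^ t ℚ.* ℤtoℚ C ^ Vec.sum ts) ℚ.* rangeSum M N f
    ≡⟨ *-distribˡ-rangeSum (ℤtoℚ C ^ t ℚ.* ℤtoℚ C ^ Vec.sum ts) M N f ⟩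
  rangeSum M N (λ n → (ℤtoℚ C ^ t ℚ.* ℤtoℚ C ^ Vec.sum ts) ℚ.* (invPow n t ℚ.* H n N ts))
    ≡⟨ rangeSum-cong M N (λ n → trans (*-interchange (ℤtoℚ C ^ t) (ℤtoℚ C ^ Vec.sum ts) (invPow n t) (H n N ts))
                                       (cong (ℚ._* scaledH C n N ts) (^-*-invPow C n t))) ⟩
  rangeSum M N (λ n → (ℤtoℚ C ℚ.* inv (ℤtoℚ n)) ^ t ℚ.* scaledH C n N ts)
    ∎
  where
  open ≡-Reasoning
  f : ℤ → ℚ
  f n = invPow n t ℚ.* H n N ts

-- p-adic valuations of rationals

module PAdic (p : ℕ) (p-prime : Prime p) where

  instance
    p≢0 : ℕ.NonZero p
    p≢0 = prime⇒nonZero p-prime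

  p∤1 : ¬ p ∣ 1
  p∤1 p∣1 = ℕP.<⇒≢ (ℕ.nonTrivial⇒n>1 p {{prime⇒nonTrivial p-prime}}) (sym (ℕD.∣1⇒≡1 p∣1))

  p∤*ℤ : ∀ a b → ¬ p ∣ ℤ.∣ a ∣ → ¬ p ∣ ℤ.∣ b ∣ → ¬ p ∣ ℤ.∣ a ℤ.* b ∣
  p∤*ℤ a b p∤a p∤b p∣ab with euclidsLemma ℤ.∣ a ∣ ℤ.∣ b ∣ p-prime (subst (p ∣_) (ℤP.abs-* a b) p∣ab)
  ... | inj₁ p∣a = p∤a p∣a
  ... | inj₂ p∣b = p∤b p∣b

  p∤⇒≢0 : ∀ v → ¬ p ∣ ℤ.∣ v ∣ → ℤtoℚ v ≢ 0ℚ
  p∤⇒≢0 v p∤v eq with ℤtoℚ-injective {v} {+ 0} eq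
  ... | refl = p∤v (p ℕD.∣0)

  p^m∣a*b⇒p^m∣a : ∀ m {a b} → ¬ p ∣ b → p ℕ.^ m ∣ a ℕ.* b → p ℕ.^ m ∣ a
  p^m∣a*b⇒p^m∣a zero {a} p∤b _ = ℕD.1∣ a
  p^m∣a*b⇒p^m∣a (suc m) {a} {b} p∤b p^[1+m]∣ab
    with euclidsLemma a b p-prime (ℕD.∣-trans (ℕD.m∣m*n (p ℕ.^ m)) p^[1+m]∣ab)
  ... | inj₂ p∣b = ⊥-elim (p∤b p∣b)
  ... | inj₁ (divides q refl) =
    subst (p ℕ.^ suc m ∣_) (ℕP.*-comm p q) (ℕD.*-monoʳ-∣ p (p^m∣a*b⇒p^m∣a m p∤b p^m∣qb))
    where
    p^m∣qb : p ℕ.^ m ∣ q ℕ.* b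
    p^m∣qb = ℕD.*-cancelˡ-∣ p (subst (p ℕ.* p ℕ.^ m ∣_) (qpb≡pqb q b) p^[1+m]∣ab)
      where
      qpb≡pqb : ∀ q b → q ℕ.* p ℕ.* b ≡ p ℕ.* (q ℕ.* b)
      qpb≡pqb q b = trans (cong (ℕ._* b) (ℕP.*-comm q p)) (ℕP.*-assoc p q b)

  record Integral (x : ℚ) : Set where
    constructor integral
    field
      den num : ℤ
      p∤den : ¬ p ∣ ℤ.∣ den ∣
      cleared : x ℚ.* ℤtoℚ den ≡ ℤtoℚ num

  Integral-ℤ : ∀ z → Integral (ℤtoℚ z)
  Integral-ℤ z = integral (+ 1) z p∤1 (ℚP.*-identityʳ (ℤtoℚ z))

  Integral-/ : ∀ u {v} → ¬ p ∣ ℤ.∣ v ∣ → Integral (ℤtoℚ u ℚ.* inv (ℤtoℚ v))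
  Integral-/ u {v} p∤v = integral v u p∤v (begin
    ℤtoℚ u ℚ.* inv (ℤtoℚ v) ℚ.* ℤtoℚ v
      ≡⟨ ℚP.*-assoc (ℤtoℚ u) _ _ ⟩
    ℤtoℚ u ℚ.* (inv (ℤtoℚ v) ℚ.* ℤtoℚ v)
      ≡⟨ cong (ℤtoℚ u ℚ.*_) (trans (ℚP.*-comm (inv (ℤtoℚ v)) (ℤtoℚ v)) (inv-inverseʳ (p∤⇒≢0 v p∤v))) ⟩
    ℤtoℚ u ℚ.* 1ℚ
      ≡⟨ ℚP.*-identityʳ (ℤtoℚ u) ⟩
    ℤtoℚ u
      ∎)
    where open ≡-Reasoning

  Integral-+ : ∀ {x y} → Integral x → Integral y → Integral (x ℚ.+ y)
  Integral-+ {x} {y} (integral d₁ n₁ p∤d₁ eq₁) (integral d₂ n₂ p∤d₂ eq₂) =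
    integral (d₁ ℤ.* d₂) (n₁ ℤ.* d₂ ℤ.+ n₂ ℤ.* d₁) (p∤*ℤ d₁ d₂ p∤d₁ p∤d₂) (begin
      (x ℚ.+ y) ℚ.* ℤtoℚ (d₁ ℤ.* d₂)
        ≡⟨ cong ((x ℚ.+ y) ℚ.*_) (ℤtoℚ-* d₁ d₂) ⟩
      (x ℚ.+ y) ℚ.* (D₁ ℚ.* D₂)
        ≡⟨ expand x y D₁ D₂ ⟩
      (x ℚ.* D₁) ℚ.* D₂ ℚ.+ (y ℚ.* D₂) ℚ.* D₁
        ≡⟨ cong₂ (λ a b → a ℚ.* D₂ ℚ.+ b ℚ.* D₁) eq₁ eq₂ ⟩
      ℤtoℚ n₁ ℚ.* D₂ ℚ.+ ℤtoℚ n₂ ℚ.* D₁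
        ≡⟨ sym (trans (ℤtoℚ-+ (n₁ ℤ.* d₂) (n₂ ℤ.* d₁)) (cong₂ ℚ._+_ (ℤtoℚ-* n₁ d₂) (ℤtoℚ-* n₂ d₁))) ⟩
      ℤtoℚ (n₁ ℤ.* d₂ ℤ.+ n₂ ℤ.* d₁)
        ∎)
    where
    open ≡-Reasoning
    open +-*-Solver
    D₁ = ℤtoℚ d₁
    D₂ = ℤtoℚ d₂
    expand : ∀ x y a b → (x ℚ.+ y) ℚ.* (a ℚ.* b) ≡ (x ℚ.* a) ℚ.* b ℚ.+ (y ℚ.* b) ℚ.* a
    expand = solve 4 (λ x y a b → (x :+ y) :* (a :* b) := (x :* a) :* b :+ (y :* b) :* a) refl

  Integral-* : ∀ {x y} → Integral x → Integral y → Integral (x ℚ.* y)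
  Integral-* {x} {y} (integral d₁ n₁ p∤d₁ eq₁) (integral d₂ n₂ p∤d₂ eq₂) =
    integral (d₁ ℤ.* d₂) (n₁ ℤ.* n₂) (p∤*ℤ d₁ d₂ p∤d₁ p∤d₂) (begin
      (x ℚ.* y) ℚ.* ℤtoℚ (d₁ ℤ.* d₂)              ≡⟨ cong ((x ℚ.* y) ℚ.*_) (ℤtoℚ-* d₁ d₂) ⟩
      (x ℚ.* y) ℚ.* (ℤtoℚ d₁ ℚ.* ℤtoℚ d₂)         ≡⟨ *-interchange x y (ℤtoℚ d₁) (ℤtoℚ d₂) ⟩
      (x ℚ.* ℤtoℚ d₁) ℚ.* (y ℚ.* ℤtoℚ d₂)         ≡⟨ cong₂ ℚ._*_ eq₁ eq₂ ⟩
      ℤtoℚ n₁ ℚ.* ℤtoℚ n₂                         ≡⟨ sym (ℤtoℚ-* n₁ n₂) ⟩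
      ℤtoℚ (n₁ ℤ.* n₂)                            ∎)
    where
    open ≡-Reasoning

  Integral-^ : ∀ {x} n → Integral x → Integral (x ^ n)
  Integral-^ zero _ = Integral-ℤ (+ 1)
  Integral-^ (suc n) x-int = Integral-* x-int (Integral-^ n x-int)

  binomNeg-integral : ∀ s l → Integral (binomNeg s l)
  binomNeg-integral s l = subst Integral (sym (binomNeg≡negBinom s l)) (Integral-ℤ (negBinom s l))

  pℚ : ℚ
  pℚ = ℤtoℚ (+ p)

  -- m ≤ᵥ x encodes v_p(x) ≥ m
  infix 4 _≤ᵥ_

  record _≤ᵥ_ (m : ℕ) (x : ℚ) : Set where
    constructor factor
    field
      cofactor : ℚ
      cofactor-integral : Integral cofactor
      factorisation : x ≡ pℚ ^ m ℚ.* cofactor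

  Integral⇒0≤ᵥ : ∀ {x} → Integral x → 0 ≤ᵥ x
  Integral⇒0≤ᵥ {x} x-int = factor x x-int (sym (ℚP.*-identityˡ x))

  ≤ᵥ⇒Integral : ∀ {m x} → m ≤ᵥ x → Integral x
  ≤ᵥ⇒Integral {m} (factor c c-int refl) = Integral-* (Integral-^ m (Integral-ℤ (+ p))) c-int

  ≤ᵥ-0 : ∀ {m} → m ≤ᵥ 0ℚ
  ≤ᵥ-0 {m} = factor 0ℚ (Integral-ℤ (+ 0)) (sym (ℚP.*-zeroʳ (pℚ ^ m)))

  ≤ᵥ-+ : ∀ {m x y} → m ≤ᵥ x → m ≤ᵥ y → m ≤ᵥ x ℚ.+ y
  ≤ᵥ-+ {m} (factor c c-int refl) (factor d d-int refl) =
    factor (c ℚ.+ d) (Integral-+ c-int d-int) (sym (ℚP.*-distribˡ-+ (pℚ ^ m) c d))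

  ≤ᵥ-* : ∀ {m n x y} → m ≤ᵥ x → n ≤ᵥ y → m ℕ.+ n ≤ᵥ x ℚ.* y
  ≤ᵥ-* {m} {n} (factor c c-int refl) (factor d d-int refl) = factor (c ℚ.* d) (Integral-* c-int d-int) (begin
    (pℚ ^ m ℚ.* c) ℚ.* (pℚ ^ n ℚ.* d)  ≡⟨ *-interchange (pℚ ^ m) c (pℚ ^ n) d ⟩
    (pℚ ^ m ℚ.* pℚ ^ n) ℚ.* (c ℚ.* d)  ≡⟨ cong (ℚ._* (c ℚ.* d)) (sym (^-homo-* pℚ m n)) ⟩
    pℚ ^ (m ℕ.+ n) ℚ.* (c ℚ.* d)       ∎)
    where
    open ≡-Reasoning

  ≤ᵥ-*ˡ : ∀ {m x y} → Integral x → m ≤ᵥ y → m ≤ᵥ x ℚ.* y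
  ≤ᵥ-*ˡ x-int = ≤ᵥ-* (Integral⇒0≤ᵥ x-int)

  ≤ᵥ-*ʳ : ∀ {m x y} → m ≤ᵥ x → Integral y → m ≤ᵥ x ℚ.* y
  ≤ᵥ-*ʳ {m} x-val y-int = subst (_≤ᵥ _) (ℕP.+-identityʳ m) (≤ᵥ-* x-val (Integral⇒0≤ᵥ y-int))

  ≤ᵥ-weaken : ∀ {m n x} → n ≤ m → m ≤ᵥ x → n ≤ᵥ x
  ≤ᵥ-weaken {m} {n} n≤m (factor c c-int refl) =
    factor (pℚ ^ (m ℕ.∸ n) ℚ.* c) (Integral-* (Integral-^ (m ℕ.∸ n) (Integral-ℤ (+ p))) c-int) (begin
      pℚ ^ m ℚ.* c                           ≡⟨ cong (λ e → pℚ ^ e ℚ.* c) (sym (ℕP.m+[n∸m]≡n n≤m)) ⟩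
      pℚ ^ (n ℕ.+ (m ℕ.∸ n)) ℚ.* c           ≡⟨ cong (ℚ._* c) (^-homo-* pℚ n (m ℕ.∸ n)) ⟩
      pℚ ^ n ℚ.* pℚ ^ (m ℕ.∸ n) ℚ.* c        ≡⟨ ℚP.*-assoc (pℚ ^ n) _ c ⟩
      pℚ ^ n ℚ.* (pℚ ^ (m ℕ.∸ n) ℚ.* c)      ∎)
    where open ≡-Reasoning

  ≤ᵥ-^ : ∀ {x} n → 1 ≤ᵥ x → n ≤ᵥ x ^ n
  ≤ᵥ-^ zero _ = Integral⇒0≤ᵥ (Integral-ℤ (+ 1))
  ≤ᵥ-^ (suc n) x-val = ≤ᵥ-* x-val (≤ᵥ-^ n x-val)

  ≤ᵥ-∑ : ∀ {m n} (f : Fin n → ℚ) → (∀ i → m ≤ᵥ f i) → m ≤ᵥ ∑[ i < n ] f i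
  ≤ᵥ-∑ {n = zero} f f-val = ≤ᵥ-0
  ≤ᵥ-∑ {n = suc n} f f-val = ≤ᵥ-+ (f-val Fin.zero) (≤ᵥ-∑ (f ∘ Fin.suc) (f-val ∘ Fin.suc))

  ≤ᵥ-rangeSum : ∀ {m} M N f → (∀ n → M ℤ.< n → n ℤ.< N → m ≤ᵥ f n) → m ≤ᵥ rangeSum M N f
  ≤ᵥ-rangeSum M N f f-val = subst (_ ≤ᵥ_) (sym (rangeSum-∑ M N f))
    (≤ᵥ-∑ (f ∘ rangeIndex M N) (λ i → f-val _ (proj₁ (rangeIndex-bounds M N i)) (proj₂ (rangeIndex-bounds M N i))))

  ≤ᵥ-boxSum : ∀ {m} d L f → (∀ v → m ≤ᵥ f v) → m ≤ᵥ boxSum d L f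
  ≤ᵥ-boxSum zero L f f-val = f-val Vec.[]
  ≤ᵥ-boxSum (suc d) L f f-val = subst (_ ≤ᵥ_) (sym (boxSum-suc d L f))
    (≤ᵥ-∑ {n = suc L} (λ j → boxSum d L (λ v → f (toℕ j Vec.∷ v)))
      (λ j → ≤ᵥ-boxSum d L (λ v → f (toℕ j Vec.∷ v)) (λ v → f-val (toℕ j Vec.∷ v))))

  ≤ᵥ⇒PAdicSmall : ∀ {m x} → m ≤ᵥ x → PAdicSmall p m x
  ≤ᵥ⇒PAdicSmall {m} {x@(mkℚ n d-1 n⊥d)} (factor c (integral v u p∤v cv≡u) x≡pᵐc) =
    inj₂ (p^m∣n , p∤d)
    where
    w = + (p ℕ.^ m) ℤ.* u
    x*v≡w : x ℚ.* ℤtoℚ v ≡ ℤtoℚ w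
    x*v≡w = begin
      x ℚ.* ℤtoℚ v                 ≡⟨ cong (ℚ._* ℤtoℚ v) x≡pᵐc ⟩
      pℚ ^ m ℚ.* c ℚ.* ℤtoℚ v      ≡⟨ ℚP.*-assoc (pℚ ^ m) c (ℤtoℚ v) ⟩
      pℚ ^ m ℚ.* (c ℚ.* ℤtoℚ v)    ≡⟨ cong₂ ℚ._*_ (sym (ℕtoℚ-^ p m)) cv≡u ⟩
      ℤtoℚ (+ (p ℕ.^ m)) ℚ.* ℤtoℚ u ≡⟨ sym (ℤtoℚ-* (+ (p ℕ.^ m)) u) ⟩
      ℤtoℚ w                       ∎
      where open ≡-Reasoning
    ∣n∣*∣v∣≡p^m*∣u∣*d : ℤ.∣ n ∣ ℕ.* ℤ.∣ v ∣ ≡ (p ℕ.^ m ℕ.* ℤ.∣ u ∣) ℕ.* suc d-1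
    ∣n∣*∣v∣≡p^m*∣u∣*d = begin
      ℤ.∣ n ∣ ℕ.* ℤ.∣ v ∣                   ≡⟨ sym (ℤP.abs-* n v) ⟩
      ℤ.∣ n ℤ.* v ∣                         ≡⟨ cong ℤ.∣_∣ (*ℤtoℚ≡ℤtoℚ⇒cross x v w x*v≡w) ⟩
      ℤ.∣ w ℤ.* + suc d-1 ∣                 ≡⟨ ℤP.abs-* w (+ suc d-1) ⟩
      ℤ.∣ w ∣ ℕ.* suc d-1                   ≡⟨ cong (ℕ._* suc d-1) (ℤP.abs-* (+ (p ℕ.^ m)) u) ⟩
      (p ℕ.^ m ℕ.* ℤ.∣ u ∣) ℕ.* suc d-1     ∎
      where open ≡-Reasoning
    p^m∣n : p ℕ.^ m ∣ ℤ.∣ n ∣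
    p^m∣n = p^m∣a*b⇒p^m∣a m p∤v (subst (p ℕ.^ m ∣_) (sym ∣n∣*∣v∣≡p^m*∣u∣*d)
      (ℕD.∣-trans (ℕD.m∣m*n ℤ.∣ u ∣) (ℕD.m∣m*n (suc d-1))))
    p∤d : ¬ p ∣ suc d-1
    p∤d p∣d = p∤v (ℕD.∣-trans p∣d (Coprime.coprime-divisor (Coprime.sym (Coprime.recompute n⊥d))
      (subst (suc d-1 ∣_) (sym ∣n∣*∣v∣≡p^m*∣u∣*d) (ℕD.n∣m*n (p ℕ.^ m ℕ.* ℤ.∣ u ∣)))))

  binomialSeries-remainder : ∀ {x w} → w ℚ.* (1ℚ ℚ.+ x) ≡ 1ℚ → Integral w → 1 ≤ᵥ x →
    ∀ s N → suc N ≤ᵥ w ^ s - binomialSeries s x N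
  binomialSeries-remainder {x} {w} w[1+x]≡1 w-int x-val = remainder
    where
    open +-*-Solver
    remainder : ∀ s N → suc N ≤ᵥ w ^ s - binomialSeries s x N
    remainder zero N = subst (_ ≤ᵥ_) (sym (trans (cong (1ℚ -_) (binomialSeries-0 x N)) (ℚP.+-inverseʳ 1ℚ))) ≤ᵥ-0
    remainder (suc s) N = subst (_ ≤ᵥ_) (sym split)
      (≤ᵥ-+ (≤ᵥ-*ˡ w-int (≤ᵥ-weaken (ℕP.n≤1+n (suc N)) (remainder s (suc N))))
            (≤ᵥ-*ˡ w-int (≤ᵥ-*ˡ (binomNeg-integral (suc s) (suc N))
                                (≤ᵥ-^ (suc N) x-val))))
      where
      open ≡-Reasoning
      T = binomialSeries (suc s) x N
      c = binomNeg (suc s) (suc N) ℚ.* x ^ suc N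
      rearrange : ∀ w x W T c → w ℚ.* W - (w ℚ.* (1ℚ ℚ.+ x)) ℚ.* T ≡ w ℚ.* (W - ((1ℚ ℚ.+ x) ℚ.* T ℚ.+ c)) ℚ.+ w ℚ.* c
      rearrange = solve 5 (λ w x W T c → w :* W :- (w :* (con 1ℚ :+ x)) :* T
                                       := w :* (W :- ((con 1ℚ :+ x) :* T :+ c)) :+ w :* c) refl
      split : w ^ suc s - T ≡ w ℚ.* (w ^ s - binomialSeries s x (suc N)) ℚ.+ w ℚ.* c
      split = begin
        w ℚ.* w ^ s - T
          ≡⟨ cong (λ t → w ℚ.* w ^ s - t) (sym (ℚP.*-identityˡ T)) ⟩
        w ℚ.* w ^ s - 1ℚ ℚ.* T
          ≡⟨ cong (λ t → w ℚ.* w ^ s - t ℚ.* T) (sym w[1+x]≡1) ⟩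
        w ℚ.* w ^ s - (w ℚ.* (1ℚ ℚ.+ x)) ℚ.* T
          ≡⟨ rearrange w x (w ^ s) T c ⟩
        w ℚ.* (w ^ s - ((1ℚ ℚ.+ x) ℚ.* T ℚ.+ c)) ℚ.+ w ℚ.* c
          ≡⟨ cong (λ t → w ℚ.* (w ^ s - t) ℚ.+ w ℚ.* c) (sym (binomialSeries-step s x N)) ⟩
        w ℚ.* (w ^ s - binomialSeries s x (suc N)) ℚ.+ w ℚ.* c
          ∎

  scaledH-valuation : ∀ {d} C (t : Vec ℕ d) M N →
    (∀ n → M ℤ.< n → n ℤ.< N → 1 ≤ᵥ ℤtoℚ C ℚ.* inv (ℤtoℚ n)) → Vec.sum t ≤ᵥ scaledH C M N t
  scaledH-valuation C Vec.[] M N _ = Integral⇒0≤ᵥ (Integral-ℤ (+ 1))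
  scaledH-valuation C (t Vec.∷ ts) M N C/n-val = subst (_ ≤ᵥ_) (sym (scaledH-cons C M N t ts))
    (≤ᵥ-rangeSum M N _ (λ n M<n n<N → ≤ᵥ-* (≤ᵥ-^ t (C/n-val n M<n n<N))
      (scaledH-valuation C ts n N (λ n′ n<n′ n′<N → C/n-val n′ (ℤP.<-trans M<n n<n′) n′<N))))

  record Split (k n : ℕ) : Set where
    constructor split
    field
      j w : ℕ
      j<k : j ℕ.< k
      n≡p^j*w : n ≡ p ℕ.^ j ℕ.* w
      p∤w : ¬ p ∣ w

  split-below : ∀ k n → 0 ℕ.< n → n ℕ.< p ℕ.^ k → Split k n
  split-below zero n 0<n n<1 = ⊥-elim (ℕP.<-irrefl refl (ℕP.<-≤-trans 0<n (ℕP.≤-pred n<1)))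
  split-below (suc k) n 0<n n<p^[1+k] with p ℕD.∣? n
  ... | no p∤n = split 0 n ℕ.z<s (sym (ℕP.*-identityˡ n)) p∤n
  ... | yes (divides zero refl) = ⊥-elim (ℕP.<-irrefl refl 0<n)
  ... | yes (divides q@(suc _) refl)
    with split-below k q ℕ.z<s (ℕP.*-cancelʳ-< p q (p ℕ.^ k) (subst (q ℕ.* p ℕ.<_) (ℕP.*-comm p (p ℕ.^ k)) n<p^[1+k]))
  ...   | split j w j<k q≡p^j*w p∤w = split (suc j) w (ℕ.s<s j<k) (begin
    q ℕ.* p                    ≡⟨ cong (ℕ._* p) q≡p^j*w ⟩
    p ℕ.^ j ℕ.* w ℕ.* p        ≡⟨ ℕP.*-comm (p ℕ.^ j ℕ.* w) p ⟩
    p ℕ.* (p ℕ.^ j ℕ.* w)      ≡⟨ sym (ℕP.*-assoc p (p ℕ.^ j) w) ⟩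
    p ℕ.^ suc j ℕ.* w          ∎) p∤w
    where open ≡-Reasoning

-- The window a p^k < n < (a+1) p^k

module Window (p : ℕ) (p-prime : Prime p) (k : ℕ) where
  open PAdic p p-prime

  P : ℕ
  P = p ℕ.^ k

  Pℚ : ℚ
  Pℚ = ℤtoℚ (+ P)

  P/_ : ℤ → ℚ
  P/ n = Pℚ ℚ.* inv (ℤtoℚ n)

  private
    ℤtoℚ-p^≢0 : ∀ j → ℤtoℚ (+ (p ℕ.^ j)) ≢ 0ℚ
    ℤtoℚ-p^≢0 j eq = ℕ.≢-nonZero⁻¹ (p ℕ.^ j) {{ℕP.m^n≢0 p j}} (ℤP.+-injective (ℤtoℚ-injective eq))

  record WindowSplit (a n : ℤ) : Set where
    field
      j e w : ℕ
      D′ : ℤ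
      P≡p^j*p^[1+e] : ℤtoℚ (+ P) ≡ ℤtoℚ (+ (p ℕ.^ j)) ℚ.* ℤtoℚ (+ (p ℕ.^ suc e))
      n≡p^j*w : ℤtoℚ n ≡ ℤtoℚ (+ (p ℕ.^ j)) ℚ.* ℤtoℚ (+ w)
      D≡p^j*D′ : ℤtoℚ (a ℤ.* + P ℤ.+ n) ≡ ℤtoℚ (+ (p ℕ.^ j)) ℚ.* ℤtoℚ D′
      p∤D′ : ¬ p ∣ ℤ.∣ D′ ∣

  window-split : ∀ a {n} → ℤ.0ℤ ℤ.< n → n ℤ.< + P → WindowSplit a n
  window-split a {+ n} (ℤ.+<+ 0<n) (ℤ.+<+ n<P) with split-below k n 0<n n<P
  ... | split j w j<k n≡p^j*w p∤w = record
    { j = j ; e = e ; w = w ; D′ = D′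
    ; P≡p^j*p^[1+e] = trans (cong ℤtoℚ P≡) (ℤtoℚ-* (+ (p ℕ.^ j)) (+ (p ℕ.^ suc e)))
    ; n≡p^j*w = trans (cong ℤtoℚ n≡) (ℤtoℚ-* (+ (p ℕ.^ j)) (+ w))
    ; D≡p^j*D′ = trans (cong ℤtoℚ D≡) (ℤtoℚ-* (+ (p ℕ.^ j)) D′)
    ; p∤D′ = p∤D′
    }
    where
    e = k ℕ.∸ suc j
    P≡ : + P ≡ + (p ℕ.^ j) ℤ.* + (p ℕ.^ suc e)
    P≡ = trans (cong (λ i → + (p ℕ.^ i)) (sym (trans (ℕP.+-suc j e) (ℕP.m+[n∸m]≡n j<k))))
           (trans (cong +_ (ℕP.^-distribˡ-+-* p j (suc e))) (ℤP.pos-* (p ℕ.^ j) (p ℕ.^ suc e)))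
    n≡ : + n ≡ + (p ℕ.^ j) ℤ.* + w
    n≡ = trans (cong +_ n≡p^j*w) (ℤP.pos-* (p ℕ.^ j) w)
    D′ = a ℤ.* + (p ℕ.^ suc e) ℤ.+ + w
    factor-out : ∀ a A B w → a ℤ.* (A ℤ.* B) ℤ.+ A ℤ.* w ≡ A ℤ.* (a ℤ.* B ℤ.+ w)
    factor-out = solve-∀
    D≡ : a ℤ.* + P ℤ.+ + n ≡ + (p ℕ.^ j) ℤ.* D′
    D≡ = trans (cong₂ (λ x y → a ℤ.* x ℤ.+ y) P≡ n≡) (factor-out a (+ (p ℕ.^ j)) (+ (p ℕ.^ suc e)) (+ w))
    p∣p^[1+e] : + p ℤD.∣ + (p ℕ.^ suc e)
    p∣p^[1+e] = ℤD.∣ᵤ⇒∣ (divides (p ℕ.^ e) (ℕP.*-comm p (p ℕ.^ e)))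
    p∤D′ : ¬ p ∣ ℤ.∣ D′ ∣
    p∤D′ p∣D′ = p∤w (ℤD.∣⇒∣ᵤ (ℤD.∣m+n∣m⇒∣n {+ p} {a ℤ.* + (p ℕ.^ suc e)} {+ w}
      (ℤD.∣ᵤ⇒∣ p∣D′) (ℤD.∣n⇒∣m*n a p∣p^[1+e])))

  module _ (a : ℤ) {n : ℤ} (0<n : ℤ.0ℤ ℤ.< n) (n<P : n ℤ.< + P) where
    open WindowSplit (window-split a 0<n n<P)

    window-≢0 : ℤtoℚ (a ℤ.* + P ℤ.+ n) ≢ 0ℚ
    window-≢0 = subst (_≢ 0ℚ) (sym D≡p^j*D′) (*-≢0 (ℤtoℚ-p^≢0 j) (p∤⇒≢0 D′ p∤D′))

    window-P/D : 1 ≤ᵥ P/ (a ℤ.* + P ℤ.+ n)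
    window-P/D = factor (ℤtoℚ (+ (p ℕ.^ e)) ℚ.* inv (ℤtoℚ D′)) (Integral-/ (+ (p ℕ.^ e)) {D′} p∤D′) (begin
      Pℚ ℚ.* inv (ℤtoℚ (a ℤ.* + P ℤ.+ n))
        ≡⟨ cong₂ (λ x y → x ℚ.* inv y) P≡p^j*p^[1+e] D≡p^j*D′ ⟩
      (p^j ℚ.* ℤtoℚ (+ (p ℕ.^ suc e))) ℚ.* inv (p^j ℚ.* ℤtoℚ D′)
        ≡⟨ *-inv-cancelˡ p^j (ℤtoℚ (+ (p ℕ.^ suc e))) (ℤtoℚ D′) (ℤtoℚ-p^≢0 j) ⟩
      ℤtoℚ (+ (p ℕ.^ suc e)) ℚ.* inv (ℤtoℚ D′)
        ≡⟨ cong (ℚ._* inv (ℤtoℚ D′)) p^[1+e]≡p*p^e ⟩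
      (pℚ ℚ.* ℤtoℚ (+ (p ℕ.^ e))) ℚ.* inv (ℤtoℚ D′)
        ≡⟨ ℚP.*-assoc pℚ (ℤtoℚ (+ (p ℕ.^ e))) (inv (ℤtoℚ D′)) ⟩
      pℚ ℚ.* (ℤtoℚ (+ (p ℕ.^ e)) ℚ.* inv (ℤtoℚ D′))
        ≡⟨ cong (ℚ._* (ℤtoℚ (+ (p ℕ.^ e)) ℚ.* inv (ℤtoℚ D′))) (sym (ℚP.*-identityʳ pℚ)) ⟩
      pℚ ^ 1 ℚ.* (ℤtoℚ (+ (p ℕ.^ e)) ℚ.* inv (ℤtoℚ D′))
        ∎)
      where
      open ≡-Reasoning
      p^j = ℤtoℚ (+ (p ℕ.^ j))
      p^[1+e]≡p*p^e : ℤtoℚ (+ (p ℕ.^ suc e)) ≡ pℚ ℚ.* ℤtoℚ (+ (p ℕ.^ e))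
      p^[1+e]≡p*p^e = trans (cong ℤtoℚ (ℤP.pos-* p (p ℕ.^ e))) (ℤtoℚ-* (+ p) (+ (p ℕ.^ e)))

    window-n/D : Integral (ℤtoℚ n ℚ.* inv (ℤtoℚ (a ℤ.* + P ℤ.+ n)))
    window-n/D = subst Integral (sym (trans (cong₂ (λ x y → x ℚ.* inv y) n≡p^j*w D≡p^j*D′)
                                            (*-inv-cancelˡ (ℤtoℚ (+ (p ℕ.^ j))) (ℤtoℚ (+ w)) (ℤtoℚ D′) (ℤtoℚ-p^≢0 j))))
                   (Integral-/ (+ w) {D′} p∤D′)

  module _ {n : ℤ} (0<n : ℤ.0ℤ ℤ.< n) (n<P : n ℤ.< + P) where
    private
      0*P+n≡n : ℤ.0ℤ ℤ.* + P ℤ.+ n ≡ n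
      0*P+n≡n = trans (cong (ℤ._+ n) (ℤP.*-zeroˡ (+ P))) (ℤP.+-identityˡ n)

    window-n≢0 : ℤtoℚ n ≢ 0ℚ
    window-n≢0 = subst (λ m → ℤtoℚ m ≢ 0ℚ) 0*P+n≡n (window-≢0 ℤ.0ℤ 0<n n<P)

    window-P/n : 1 ≤ᵥ P/ n
    window-P/n = subst (λ m → 1 ≤ᵥ P/ m) 0*P+n≡n (window-P/D ℤ.0ℤ 0<n n<P)

  window-range : ∀ {M} → ℤ.0ℤ ℤ.≤ M → ∀ n → M ℤ.< n → n ℤ.< + P → 1 ≤ᵥ P/ n
  window-range 0≤M n M<n n<P = window-P/n (ℤP.≤-<-trans 0≤M M<n) n<P

-- Expansion of ζ_{f^{k;a}} around the window (0, p^k)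

module Expansion (p : ℕ) (p-prime : Prime p) (k : ℕ) (a : ℤ) where
  open PAdic p p-prime
  open Window p p-prime k

  aP : ℤ
  aP = a ℤ.* + P

  -- At M = 0 these are ζ_{f^{k;a}}(s) and the partial sum of the series over l ∈ [0, N]^d;
  -- the induction on the depth moves the lower summation bound M through the window.
  shiftedζ : ∀ {d} → Vec ℕ d → ℤ → ℚ
  shiftedζ s M = scaledH (+ P) (aP ℤ.+ M) (aP ℤ.+ + P) s

  truncatedSeries : ∀ {d} → Vec ℕ d → ℕ → ℤ → ℚ
  truncatedSeries {d} s N M = boxSum d N (λ l → prodBin a s l ℚ.* scaledH (+ P) M (+ P) (Vec.zipWith ℕ._+_ s l))

  shiftedFactor : ℕ → ℤ → ℚ
  shiftedFactor s n = (P/ (aP ℤ.+ n)) ^ s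

  truncatedFactor : ℕ → ℕ → ℤ → ℚ
  truncatedFactor s N n = ∑[ j ≤ N ] (binomNeg s (toℕ j) ℚ.* ℤtoℚ (a ℤ.^ toℕ j) ℚ.* (P/ n) ^ (s ℕ.+ toℕ j))

  shiftedζ-cons : ∀ {d} s (ss : Vec ℕ d) M →
    shiftedζ (s Vec.∷ ss) M ≡ rangeSum M (+ P) (λ n → shiftedFactor s n ℚ.* shiftedζ ss n)
  shiftedζ-cons s ss M = trans (scaledH-cons (+ P) (aP ℤ.+ M) (aP ℤ.+ + P) s ss)
    (rangeSum-shift aP M (+ P) (λ n → (P/ n) ^ s ℚ.* scaledH (+ P) n (aP ℤ.+ + P) ss))

  truncatedSeries-cons : ∀ {d} s (ss : Vec ℕ d) N M →
    truncatedSeries (s Vec.∷ ss) N M ≡ rangeSum M (+ P) (λ n → truncatedFactor s N n ℚ.* truncatedSeries ss N n)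
  truncatedSeries-cons {d} s ss N M = begin
    boxSum (suc d) N F
      ≡⟨ boxSum-suc d N F ⟩
    ∑[ j ≤ N ] boxSum d N (λ ls → F (toℕ j Vec.∷ ls))
      ≡⟨ sum-cong-≗ {suc N} (λ j → column (toℕ j)) ⟩
    ∑[ j ≤ N ] rangeSum M (+ P) (λ n → c (toℕ j) n ℚ.* truncatedSeries ss N n)
      ≡⟨ ∑-rangeSum-comm (suc N) M (+ P) (λ j n → c (toℕ j) n ℚ.* truncatedSeries ss N n) ⟩
    rangeSum M (+ P) (λ n → ∑[ j ≤ N ] (c (toℕ j) n ℚ.* truncatedSeries ss N n))
      ≡⟨ rangeSum-cong M (+ P) (λ n → sym (*-distribʳ-sum {suc N} (truncatedSeries ss N n) (λ j → c (toℕ j) n))) ⟩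
    rangeSum M (+ P) (λ n → truncatedFactor s N n ℚ.* truncatedSeries ss N n)
      ∎
    where
    open ≡-Reasoning
    F : Vec ℕ (suc d) → ℚ
    F l = prodBin a (s Vec.∷ ss) l ℚ.* scaledH (+ P) M (+ P) (Vec.zipWith ℕ._+_ (s Vec.∷ ss) l)
    c : ℕ → ℤ → ℚ
    c j n = binomNeg s j ℚ.* ℤtoℚ (a ℤ.^ j) ℚ.* (P/ n) ^ (s ℕ.+ j)
    G : Vec ℕ d → ℤ → ℚ
    G ls n = prodBin a ss ls ℚ.* scaledH (+ P) n (+ P) (Vec.zipWith ℕ._+_ ss ls)
    entry : ∀ j ls → F (j Vec.∷ ls) ≡ rangeSum M (+ P) (λ n → c j n ℚ.* G ls n)
    entry j ls = begin
      (b ℚ.* pb) ℚ.* scaledH (+ P) M (+ P) ((s ℕ.+ j) Vec.∷ z)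
        ≡⟨ cong ((b ℚ.* pb) ℚ.*_) (scaledH-cons (+ P) M (+ P) (s ℕ.+ j) z) ⟩
      (b ℚ.* pb) ℚ.* rangeSum M (+ P) (λ n → (P/ n) ^ (s ℕ.+ j) ℚ.* scaledH (+ P) n (+ P) z)
        ≡⟨ *-distribˡ-rangeSum (b ℚ.* pb) M (+ P) (λ n → (P/ n) ^ (s ℕ.+ j) ℚ.* scaledH (+ P) n (+ P) z) ⟩
      rangeSum M (+ P) (λ n → (b ℚ.* pb) ℚ.* ((P/ n) ^ (s ℕ.+ j) ℚ.* scaledH (+ P) n (+ P) z))
        ≡⟨ rangeSum-cong M (+ P) (λ n → *-interchange b pb ((P/ n) ^ (s ℕ.+ j)) (scaledH (+ P) n (+ P) z)) ⟩
      rangeSum M (+ P) (λ n → c j n ℚ.* G ls n)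
        ∎
      where
      b = binomNeg s j ℚ.* ℤtoℚ (a ℤ.^ j)
      pb = prodBin a ss ls
      z = Vec.zipWith ℕ._+_ ss ls
    column : ∀ j → boxSum d N (λ ls → F (j Vec.∷ ls)) ≡ rangeSum M (+ P) (λ n → c j n ℚ.* truncatedSeries ss N n)
    column j = begin
      boxSum d N (λ ls → F (j Vec.∷ ls))
        ≡⟨ boxSum-cong d N (entry j) ⟩
      boxSum d N (λ ls → rangeSum M (+ P) (λ n → c j n ℚ.* G ls n))
        ≡⟨ boxSum-rangeSum-comm d N M (+ P) (λ ls n → c j n ℚ.* G ls n) ⟩
      rangeSum M (+ P) (λ n → boxSum d N (λ ls → c j n ℚ.* G ls n))
        ≡⟨ rangeSum-cong M (+ P) (λ n → sym (*-distribˡ-boxSum (c j n) d N (λ ls → G ls n))) ⟩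
      rangeSum M (+ P) (λ n → c j n ℚ.* truncatedSeries ss N n)
        ∎

  factor-difference : ∀ s N {n} → ℤ.0ℤ ℤ.< n → n ℤ.< + P → suc N ≤ᵥ shiftedFactor s n - truncatedFactor s N n
  -- With y = P/n, w = n/(aP+n) and x = a y one has P/(aP+n) = y w and w (1 + x) = 1, so the difference
  -- is y^s times the remainder of the binomial series of (1 + x)^(-s) = w^s.
  factor-difference s N {n} 0<n n<P = subst (suc N ≤ᵥ_) (sym difference≡)
    (≤ᵥ-*ˡ (Integral-^ s (≤ᵥ⇒Integral (window-P/n 0<n n<P)))
           (binomialSeries-remainder w[1+x]≡1 (window-n/D a 0<n n<P) (≤ᵥ-*ˡ (Integral-ℤ a) (window-P/n 0<n n<P)) s N))
    where
    open ≡-Reasoning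
    open +-*-Solver
    nℚ = ℤtoℚ n
    D = ℤtoℚ (aP ℤ.+ n)
    y = P/ n
    w = nℚ ℚ.* inv D
    x = ℤtoℚ a ℚ.* y
    D≡aP+n : D ≡ ℤtoℚ a ℚ.* Pℚ ℚ.+ nℚ
    D≡aP+n = trans (ℤtoℚ-+ aP n) (cong (ℚ._+ nℚ) (ℤtoℚ-* a (+ P)))
    n*inv[n]≡1 : nℚ ℚ.* inv nℚ ≡ 1ℚ
    n*inv[n]≡1 = inv-inverseʳ (window-n≢0 0<n n<P)
    w[1+x]≡1 : w ℚ.* (1ℚ ℚ.+ x) ≡ 1ℚ
    w[1+x]≡1 = begin
      (nℚ ℚ.* inv D) ℚ.* (1ℚ ℚ.+ ℤtoℚ a ℚ.* (Pℚ ℚ.* inv nℚ))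
        ≡⟨ expand nℚ (inv nℚ) (inv D) (ℤtoℚ a) Pℚ ⟩
      (ℤtoℚ a ℚ.* Pℚ ℚ.* (nℚ ℚ.* inv nℚ) ℚ.+ nℚ) ℚ.* inv D
        ≡⟨ cong (λ t → (ℤtoℚ a ℚ.* Pℚ ℚ.* t ℚ.+ nℚ) ℚ.* inv D) n*inv[n]≡1 ⟩
      (ℤtoℚ a ℚ.* Pℚ ℚ.* 1ℚ ℚ.+ nℚ) ℚ.* inv D
        ≡⟨ cong (λ t → (t ℚ.+ nℚ) ℚ.* inv D) (ℚP.*-identityʳ (ℤtoℚ a ℚ.* Pℚ)) ⟩
      (ℤtoℚ a ℚ.* Pℚ ℚ.+ nℚ) ℚ.* inv D
        ≡⟨ cong (ℚ._* inv D) (sym D≡aP+n) ⟩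
      D ℚ.* inv D
        ≡⟨ inv-inverseʳ (window-≢0 a 0<n n<P) ⟩
      1ℚ
        ∎
      where
      expand : ∀ N iN iD A P → (N ℚ.* iD) ℚ.* (1ℚ ℚ.+ A ℚ.* (P ℚ.* iN)) ≡ (A ℚ.* P ℚ.* (N ℚ.* iN) ℚ.+ N) ℚ.* iD
      expand = solve 5 (λ N iN iD A P → (N :* iD) :* (con 1ℚ :+ A :* (P :* iN)) := (A :* P :* (N :* iN) :+ N) :* iD) refl
    P/D≡y*w : P/ (aP ℤ.+ n) ≡ y ℚ.* w
    P/D≡y*w = begin
      Pℚ ℚ.* inv D
        ≡⟨ cong (ℚ._* inv D) (sym (ℚP.*-identityʳ Pℚ)) ⟩
      Pℚ ℚ.* 1ℚ ℚ.* inv D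
        ≡⟨ cong (λ t → Pℚ ℚ.* t ℚ.* inv D) (sym (trans (ℚP.*-comm (inv nℚ) nℚ) n*inv[n]≡1)) ⟩
      Pℚ ℚ.* (inv nℚ ℚ.* nℚ) ℚ.* inv D
        ≡⟨ regroup Pℚ (inv nℚ) nℚ (inv D) ⟩
      (Pℚ ℚ.* inv nℚ) ℚ.* (nℚ ℚ.* inv D)
        ∎
      where
      regroup : ∀ P iN N iD → P ℚ.* (iN ℚ.* N) ℚ.* iD ≡ (P ℚ.* iN) ℚ.* (N ℚ.* iD)
      regroup = solve 4 (λ P iN N iD → P :* (iN :* N) :* iD := (P :* iN) :* (N :* iD)) refl
    coefficient : ∀ j → binomNeg s j ℚ.* ℤtoℚ (a ℤ.^ j) ℚ.* y ^ (s ℕ.+ j) ≡ y ^ s ℚ.* (binomNeg s j ℚ.* x ^ j)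
    coefficient j = begin
      binomNeg s j ℚ.* ℤtoℚ (a ℤ.^ j) ℚ.* y ^ (s ℕ.+ j)
        ≡⟨ cong₂ (λ u v → binomNeg s j ℚ.* u ℚ.* v) (ℤtoℚ-^ a j) (^-homo-* y s j) ⟩
      binomNeg s j ℚ.* ℤtoℚ a ^ j ℚ.* (y ^ s ℚ.* y ^ j)
        ≡⟨ regroup (binomNeg s j) (ℤtoℚ a ^ j) (y ^ s) (y ^ j) ⟩
      y ^ s ℚ.* (binomNeg s j ℚ.* (ℤtoℚ a ^ j ℚ.* y ^ j))
        ≡⟨ cong (λ t → y ^ s ℚ.* (binomNeg s j ℚ.* t)) (sym (^-distrib-* (ℤtoℚ a) y j)) ⟩
      y ^ s ℚ.* (binomNeg s j ℚ.* x ^ j)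
        ∎
      where
      regroup : ∀ b A Y Z → b ℚ.* A ℚ.* (Y ℚ.* Z) ≡ Y ℚ.* (b ℚ.* (A ℚ.* Z))
      regroup = solve 4 (λ b A Y Z → b :* A :* (Y :* Z) := Y :* (b :* (A :* Z))) refl
    difference≡ : shiftedFactor s n - truncatedFactor s N n ≡ y ^ s ℚ.* (w ^ s - binomialSeries s x N)
    difference≡ = begin
      (P/ (aP ℤ.+ n)) ^ s - truncatedFactor s N n
        ≡⟨ cong₂ _-_ (trans (cong (_^ s) P/D≡y*w) (^-distrib-* y w s)) (sum-cong-≗ {suc N} (coefficient ∘ toℕ)) ⟩
      y ^ s ℚ.* w ^ s - ∑[ j ≤ N ] (y ^ s ℚ.* (binomNeg s (toℕ j) ℚ.* x ^ toℕ j))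
        ≡⟨ cong (y ^ s ℚ.* w ^ s -_) (sym (*-distribˡ-sum {suc N} (y ^ s) (λ j → binomNeg s (toℕ j) ℚ.* x ^ toℕ j))) ⟩
      y ^ s ℚ.* w ^ s - y ^ s ℚ.* binomialSeries s x N
        ≡⟨ factor-out (y ^ s) (w ^ s) (binomialSeries s x N) ⟩
      y ^ s ℚ.* (w ^ s - binomialSeries s x N)
        ∎
      where
      factor-out : ∀ Y W T → Y ℚ.* W - Y ℚ.* T ≡ Y ℚ.* (W - T)
      factor-out = solve 3 (λ Y W T → Y :* W :- Y :* T := Y :* (W :- T)) refl

  prodBin-integral : ∀ {d} (s l : Vec ℕ d) → Integral (prodBin a s l)
  prodBin-integral Vec.[] Vec.[] = Integral-ℤ (+ 1)
  prodBin-integral (s Vec.∷ ss) (l Vec.∷ ls) =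
    Integral-* (Integral-* (binomNeg-integral s l) (Integral-ℤ (a ℤ.^ l)))
               (prodBin-integral ss ls)

  truncatedSeries-integral : ∀ {d} (s : Vec ℕ d) N {M} → ℤ.0ℤ ℤ.≤ M → Integral (truncatedSeries s N M)
  truncatedSeries-integral {d} s N {M} 0≤M = ≤ᵥ⇒Integral (≤ᵥ-boxSum d N _ λ l → Integral⇒0≤ᵥ (Integral-*
    (prodBin-integral s l) (≤ᵥ⇒Integral (scaledH-valuation (+ P) (Vec.zipWith ℕ._+_ s l) M (+ P) (window-range 0≤M)))))

  shiftedζ≈truncatedSeries : ∀ {d} (s : Vec ℕ d) {m N} → m ≤ N → ∀ {M} → ℤ.0ℤ ℤ.≤ M →
    m ≤ᵥ shiftedζ s M - truncatedSeries s N M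
  shiftedζ≈truncatedSeries Vec.[] m≤N 0≤M = ≤ᵥ-0
  shiftedζ≈truncatedSeries (s Vec.∷ ss) {m} {N} m≤N {M} 0≤M =
    subst (m ≤ᵥ_) (sym difference) (≤ᵥ-rangeSum M (+ P) _ termwise)
    where
    A = shiftedFactor s
    B = truncatedFactor s N
    R = shiftedζ ss
    T = λ n → truncatedSeries ss N n
    difference : shiftedζ (s Vec.∷ ss) M - truncatedSeries (s Vec.∷ ss) N M
               ≡ rangeSum M (+ P) (λ n → A n ℚ.* R n - B n ℚ.* T n)
    difference = trans (cong₂ _-_ (shiftedζ-cons s ss M) (truncatedSeries-cons s ss N M))
                       (rangeSum-distrib-- M (+ P) (λ n → A n ℚ.* R n) (λ n → B n ℚ.* T n))
    open +-*-Solver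
    regroup : ∀ A R B T → A ℚ.* R - B ℚ.* T ≡ A ℚ.* (R - T) ℚ.+ (A - B) ℚ.* T
    regroup = solve 4 (λ A R B T → A :* R :- B :* T := A :* (R :- T) :+ (A :- B) :* T) refl
    -- A R − B T = A (R − T) + (A − B) T: the first term by induction, the second by the binomial remainder.
    termwise : ∀ n → M ℤ.< n → n ℤ.< + P → m ≤ᵥ A n ℚ.* R n - B n ℚ.* T n
    termwise n M<n n<P = subst (m ≤ᵥ_) (sym (regroup (A n) (R n) (B n) (T n)))
      (≤ᵥ-+ (≤ᵥ-*ˡ (Integral-^ s (≤ᵥ⇒Integral (window-P/D a 0<n n<P))) (shiftedζ≈truncatedSeries ss m≤N 0≤n))
            (≤ᵥ-*ʳ (≤ᵥ-weaken (ℕP.m≤n⇒m≤1+n m≤N) (factor-difference s N 0<n n<P)) (truncatedSeries-integral ss N 0≤n)))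
      where
      0<n = ℤP.≤-<-trans 0≤M M<n
      0≤n = ℤP.<⇒≤ 0<n

  ζf≡scaledH : ∀ {d} b (s : Vec ℕ d) → ζf p k b s ≡ scaledH (+ P) (b ℤ.* + P) (b ℤ.* + P ℤ.+ + P) s
  ζf≡scaledH b s = cong₂ ℚ._*_ (ℕtoℚ-^ P (Vec.sum s)) (cong (λ U → H (b ℤ.* + P) U s) ([b+1]P≡bP+P b (+ P)))
    where
    [b+1]P≡bP+P : ∀ b P → (b ℤ.+ ℤ.1ℤ) ℤ.* P ≡ b ℤ.* P ℤ.+ P
    [b+1]P≡bP+P = solve-∀

  ζf≡shiftedζ : ∀ {d} (s : Vec ℕ d) → ζf p k a s ≡ shiftedζ s ℤ.0ℤ
  ζf≡shiftedζ s = trans (ζf≡scaledH a s) (cong (λ L → scaledH (+ P) L (aP ℤ.+ + P) s) (sym (ℤP.+-identityʳ aP)))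

  term≡prodBin*scaledH : ∀ {d} (s l : Vec ℕ d) → term p k a s l ≡ prodBin a s l ℚ.* scaledH (+ P) ℤ.0ℤ (+ P) (Vec.zipWith ℕ._+_ s l)
  term≡prodBin*scaledH s l = cong (prodBin a s l ℚ.*_) (trans (ζf≡scaledH ℤ.0ℤ t)
    (cong₂ (λ L U → scaledH (+ P) L U t) (ℤP.*-zeroˡ (+ P))
      (trans (cong (ℤ._+ + P) (ℤP.*-zeroˡ (+ P))) (ℤP.+-identityˡ (+ P)))))
    where t = Vec.zipWith ℕ._+_ s l

Any-≤-sum-zipWith : ∀ {d m} (s l : Vec ℕ d) → Any (m ≤_) l → m ≤ Vec.sum (Vec.zipWith ℕ._+_ s l)
Any-≤-sum-zipWith (s Vec.∷ ss) (l Vec.∷ ls) (here m≤l) =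
  ℕP.≤-trans m≤l (ℕP.≤-trans (ℕP.m≤n+m l s) (ℕP.m≤m+n (s ℕ.+ l) _))
Any-≤-sum-zipWith (s Vec.∷ ss) (l Vec.∷ ls) (there m≤lᵢ) =
  ℕP.≤-trans (Any-≤-sum-zipWith ss ls m≤lᵢ) (ℕP.m≤n+m _ (s ℕ.+ l))

corollary5p3 : (a : ℤ) (k d : ℕ) → k ≢ 0 → d ≢ 0 → (s : Vec ℕ d) → All (_≢ 0) s →
    (p : ℕ) → Prime p →
    ((m : ℕ) → ∃[ L ] ((l : Vec ℕ d) → Any (L ≤_) l → PAdicSmall p m (term p k a s l)))
    × ((m : ℕ) → ∃[ L ] ((N : ℕ) → L ≤ N →
        PAdicSmall p m (ζf p k a s - boxSum d N (term p k a s))))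
corollary5p3 a k d _ _ s _ p p-prime = terms-small , partial-sums-close
  where
  open PAdic p p-prime
  open Window p p-prime k
  open Expansion p p-prime k a
  terms-small : (m : ℕ) → ∃[ L ] ((l : Vec ℕ d) → Any (L ≤_) l → PAdicSmall p m (term p k a s l))
  terms-small m = m , λ l m≤lᵢ → ≤ᵥ⇒PAdicSmall (subst (m ≤ᵥ_) (sym (term≡prodBin*scaledH s l))
    (≤ᵥ-*ˡ (prodBin-integral s l) (≤ᵥ-weaken (Any-≤-sum-zipWith s l m≤lᵢ)
      (scaledH-valuation (+ P) (Vec.zipWith ℕ._+_ s l) ℤ.0ℤ (+ P) (window-range ℤP.≤-refl)))))
  partial-sums-close : (m : ℕ) → ∃[ L ] ((N : ℕ) → L ≤ N → PAdicSmall p m (ζf p k a s - boxSum d N (term p k a s)))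
  partial-sums-close m = m , λ N m≤N → ≤ᵥ⇒PAdicSmall (subst (m ≤ᵥ_)
    (cong₂ _-_ (sym (ζf≡shiftedζ s)) (boxSum-cong d N (λ l → sym (term≡prodBin*scaledH s l))))
    (shiftedζ≈truncatedSeries s m≤N ℤP.≤-refl))
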